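{- Let $n\ge 13$ and let $S$ be a locating code in $G=\mathrm{C}_n(1,3)$. Let $u\in S$ be a heavy vertex, i.e. $\gamma(u)>3$. Then $\pi(u)$ is either $(1,1,2,2,3)$ or $(1,1,2,3,4)$. Moreover, one may assign to each heavy vertex $u\in S$ a vertex $u'\in S$ (its mate) such that $\gamma(u)+\gamma(u')\le 6$, in such a way that distinct heavy vertices have distinct mates.
   Context: $\mathrm{C}_n(1,3)$ has vertex set $\mathbb{Z}_n$, with $x,y$ adjacent iff $x-y\equiv\pm1$ or $\pm3\pmod n$; it is 4-regular. For $u\in\mathbb{Z}_n$, $N[u]$ is its closed neighbourhood and $S_u=N[u]\cap S$ its shadow on $S$. $S$ is a locating code if the sets $S_u$, $u\in \mathbb{Z}_n\setminus S$, are all nonempty and pairwise distinct (so every vertex has nonempty shadow). The profile $\pi(u)$ of $u$ is the 5-tuple of the numbers $|S_x|$, $x\in N[u]$, listed in ascending order. The share of $u\in S$ is $\gamma(u)=\sum_{x\in N[u]}1/|S_x|$. -}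

module Defs where

open import Data.Bool using (Bool; true; false; if_then_else_)
open import Data.Nat as ℕ using (ℕ; zero; suc; _+_; _∸_; _%_)
open import Data.Nat.Properties as ℕP using (≤-decTotalOrder)
open import Data.Fin using (Fin; toℕ)
open import Data.Fin.Subset using (Subset; _∩_; ∣_∣)
open import Data.Vec using (tabulate)
open import Data.List using (List; []; _∷_; map; foldr; filter)
open import Data.List.Base using (allFin)
open import Data.Integer using (+_)
open import Data.Rational using (ℚ; 0ℚ; _/_)
import Data.Rational as ℚ
open import Relation.Nullary.Decidable using (Dec; yes; no; ⌊_⌋; _⊎-dec_)
import Data.List.Sort.InsertionSort.Base as ISort
open import Relation.Binary.PropositionalEquality using (_≡_; _≢_)
open import Data.Sum using (_⊎_)

-- Vertices of C_n(1,3) are Fin n (representing Z_n).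
-- dist n x y = (x - y) mod n, as a natural number in [0, n).
diff : (n : ℕ) → Fin n → Fin n → ℕ
diff zero () _
diff (suc m) x y = (toℕ x + (suc m ∸ toℕ y)) % suc m

InClosedNbhd : (n : ℕ) → Fin n → Fin n → Set
InClosedNbhd n x y =
  let d = diff n x y in
  (d ≡ 0) ⊎ ((d ≡ 1) ⊎ ((d ≡ (n ∸ 1)) ⊎ ((d ≡ 3) ⊎ (d ≡ (n ∸ 3)))))

inClosedNbhd? : (n : ℕ) (x y : Fin n) → Dec (InClosedNbhd n x y)
inClosedNbhd? n x y =
  let d = diff n x y in
  (d ℕ.≟ 0) ⊎-dec ((d ℕ.≟ 1) ⊎-dec ((d ℕ.≟ (n ∸ 1)) ⊎-dec ((d ℕ.≟ 3) ⊎-dec (d ℕ.≟ (n ∸ 3)))))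

N[_] : {n : ℕ} → Fin n → Subset n
N[_] {n} u = tabulate (λ x → ⌊ inClosedNbhd? n x u ⌋)

shadow : {n : ℕ} → Subset n → Fin n → Subset n
shadow S u = N[ u ] ∩ S

nbhdList : {n : ℕ} → Fin n → List (Fin n)
nbhdList {n} u = filter (λ x → inClosedNbhd? n x u) (allFin n)

open import Data.Fin.Subset using (_∈_; _∉_; Nonempty)
open import Data.Product using (_×_)

IsLocatingCode : {n : ℕ} → Subset n → Set
IsLocatingCode {n} S =
  ((u : Fin n) → u ∉ S → Nonempty (shadow S u)) ×
  ((u v : Fin n) → u ∉ S → v ∉ S → u ≢ v → shadow S u ≢ shadow S v)

-- 1/k in ℚ (with the convention 1/0 = 0; for u ∈ S every x ∈ N[u] has u ∈ S_x,
-- so the convention is never used in the share of a codeword)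
recip : ℕ → ℚ
recip zero = 0ℚ
recip (suc k) = + 1 / suc k

share : {n : ℕ} → Subset n → Fin n → ℚ
share S u = foldr (λ x acc → recip ∣ shadow S x ∣ ℚ.+ acc) 0ℚ (nbhdList u)

profile : {n : ℕ} → Subset n → Fin n → List ℕ
profile S u = ISort.sort ≤-decTotalOrder (map (λ x → ∣ shadow S x ∣) (nbhdList u))

Heavy : {n : ℕ} → Subset n → Fin n → Set
Heavy S u = (+ 3 / 1) ℚ.< share S u

module Submission where

-- Everything the theorem says about a codeword u is determined by the code near u: shadows use the
-- offsets 0, ±1, ±3, so the share and profile of u read S only on [u − 6, u + 6], and those of u + d
-- only on [u + d − 6, u + d + 6]. As n ≥ 13, distinct offsets of size at most 12 name distinct
-- vertices, so the locating conditions at u − 3, …, u + 3 become conditions on the window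
-- S ∩ [u − 6, u + 6], read as a pattern on ℤ. A search over all 2¹³ windows shows that a heavy
-- codeword has one of six windows, each with one of the two claimed profiles. For each of them a mate
-- u + d with |d| ≤ 4 is fixed, and a search over the 2⁸ extensions of the window to [u − 10, u + 10]
-- gives u + d ∈ S and γ(u) + γ(u + d) ≤ 6. Finally, if heavy codewords u and v with windows i and j
-- have the same mate, then v = u + (d_i − d_j), and for every pair (i, j) with d_i ≠ d_j the two
-- windows contradict each other on their overlap.

open import Data.Nat using (ℕ; suc; _≤_)
open import Data.Fin.Subset using (Subset)
open import Defs using (IsLocatingCode)

module Cyclic where
  open import Data.Nat as ℕ using (ℕ; suc; NonZero)
  import Data.Nat.Properties as ℕP
  open import Data.Nat.DivMod using (_%_; _/_; m≡m%n+[m/n]*n; m%n<n)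
  open import Data.Integer using (ℤ; +_; 0ℤ; 1ℤ; _⊖_; _+_; _*_; -_; _-_; ∣_∣)
  import Data.Integer.Properties as ℤP
  open import Data.Integer.DivMod using (_%ℕ_; _/ℕ_; a≡a%ℕn+[a/ℕn]*n; n%ℕd<d)
  open import Data.Integer.Tactic.RingSolver using (solve-∀)
  open import Data.Fin using (Fin; toℕ; fromℕ<)
  open import Data.Fin.Properties using (toℕ-fromℕ<; toℕ-injective; toℕ<n)
  open import Relation.Binary.PropositionalEquality
  open import Defs using (diff)

  small-multiple≡0 : ∀ {n c} j → c ≡ j * + n → ∣ c ∣ ℕ.< n → c ≡ 0ℤ
  small-multiple≡0 {n} j refl lt = cong (_* + n) (ℤP.∣i∣≡0⇒i≡0 {j} (ℕP.n<1⇒n≡0 ∣j∣<1))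
    where
    ∣j∣<1 : ∣ j ∣ ℕ.< 1
    ∣j∣<1 = ℕP.*-cancelʳ-< n ∣ j ∣ 1 (subst₂ ℕ._<_ (ℤP.abs-* j (+ n)) (sym (ℕP.*-identityˡ n)) lt)

  ∣+r-+e∣<n : ∀ {n r e} → r ℕ.< n → e ℕ.< n → ∣ + r - + e ∣ ℕ.< n
  ∣+r-+e∣<n {n} {r} {e} r<n e<n = begin-strict
    ∣ + r - + e ∣  ≡⟨ cong ∣_∣ (ℤP.[+m]-[+n]≡m⊖n r e) ⟩
    ∣ r ⊖ e ∣      ≤⟨ ℤP.∣m⊝n∣≤m⊔n r e ⟩
    r ℕ.⊔ e        <⟨ ℕP.⊔-pres-<m r<n e<n ⟩
    n              ∎
    where open ℕP.≤-Reasoning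

  +[m∸n]≡+m-+n : ∀ {m n} → n ℕ.≤ m → + (m ℕ.∸ n) ≡ + m - + n
  +[m∸n]≡+m-+n {m} {n} n≤m = sym (trans (ℤP.[+m]-[+n]≡m⊖n m n) (ℤP.⊖-≥ n≤m))

  module _ {n : ℕ} where

    record Shift (u : Fin n) (d : ℤ) (v : Fin n) : Set where
      constructor shift
      field
        quotient : ℤ
        equation : + toℕ v ≡ + toℕ u + d + quotient * + n

    shift-refl : ∀ {u} → Shift u 0ℤ u
    shift-refl {u} = shift 0ℤ (pad (+ toℕ u) (+ n))
      where
      pad : ∀ x c → x ≡ x + 0ℤ + 0ℤ * c
      pad = solve-∀

    shift-sym : ∀ {u a v} → Shift u a v → Shift v (- a) u
    shift-sym {u} {a} {v} (shift k eq) = shift (- k) (begin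
      + toℕ u                                    ≡⟨ cancel (+ toℕ u) a k (+ n) ⟩
      (+ toℕ u + a + k * + n) + - a + - k * + n  ≡⟨ cong (λ t → t + - a + - k * + n) (sym eq) ⟩
      + toℕ v + - a + - k * + n                  ∎)
      where
      open ≡-Reasoning
      cancel : ∀ x a k c → x ≡ (x + a + k * c) + - a + - k * c
      cancel = solve-∀

    shift-trans : ∀ {u a v b w} → Shift u a v → Shift v b w → Shift u (a + b) w
    shift-trans {u} {a} {v} {b} {w} (shift k eq) (shift l eq′) = shift (k + l) (begin
      + toℕ w                            ≡⟨ eq′ ⟩
      + toℕ v + b + l * + n              ≡⟨ cong (λ t → t + b + l * + n) eq ⟩
      + toℕ u + a + k * + n + b + l * + n ≡⟨ regroup (+ toℕ u) a b k l (+ n) ⟩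
      + toℕ u + (a + b) + (k + l) * + n  ∎)
      where
      open ≡-Reasoning
      regroup : ∀ x a b k l c → x + a + k * c + b + l * c ≡ x + (a + b) + (k + l) * c
      regroup = solve-∀

    shift-add-period : ∀ {u a v} j → Shift u a v → Shift u (a + j * + n) v
    shift-add-period {u} {a} j (shift k eq) = shift (k - j) (trans eq (regroup (+ toℕ u) a j k (+ n)))
      where
      regroup : ∀ x a j k c → x + a + k * c ≡ x + (a + j * c) + (k - j) * c
      regroup = solve-∀

    shift-offset-unique : ∀ {u a b v} → Shift u a v → Shift u b v → ∣ a - b ∣ ℕ.< n → a ≡ b
    shift-offset-unique {u} {a} {b} {v} (shift k eq) (shift l eq′) lt =
      ℤP.i-j≡0⇒i≡j a b (small-multiple≡0 (l - k) (ℤP.i-j≡0⇒i≡j _ _ (begin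
        a - b - (l - k) * + n                        ≡⟨ regroup (+ toℕ u) a b k l (+ n) ⟩
        (+ toℕ u + a + k * + n) - (+ toℕ u + b + l * + n) ≡⟨ cong₂ _-_ eq eq′ ⟨
        + toℕ v - + toℕ v                            ≡⟨ ℤP.+-inverseʳ (+ toℕ v) ⟩
        0ℤ                                           ∎)) lt)
      where
      open ≡-Reasoning
      regroup : ∀ x a b k l c → a - b - (l - k) * c ≡ (x + a + k * c) - (x + b + l * c)
      regroup = solve-∀

    shift-target-unique : ∀ {u a v w} → Shift u a v → Shift u a w → v ≡ w
    shift-target-unique {u} {a} {v} {w} (shift k eq) (shift l eq′) =
      toℕ-injective (ℤP.+-injective (ℤP.i-j≡0⇒i≡j _ _
        (small-multiple≡0 (k - l) v-w≡ (∣+r-+e∣<n (toℕ<n v) (toℕ<n w)))))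
      where
      regroup : ∀ x a k l c → (x + a + k * c) - (x + a + l * c) ≡ (k - l) * c
      regroup = solve-∀
      v-w≡ : + toℕ v - + toℕ w ≡ (k - l) * + n
      v-w≡ = trans (cong₂ _-_ eq eq′) (regroup (+ toℕ u) a k l (+ n))

  module _ {n : ℕ} .{{_ : NonZero n}} where

    infixl 6 _⊕_
    _⊕_ : Fin n → ℤ → Fin n
    u ⊕ d = fromℕ< (n%ℕd<d (+ toℕ u + d) n)

    shift-⊕ : ∀ u d → Shift u d (u ⊕ d)
    shift-⊕ u d = shift (- (a /ℕ n)) (begin
      + toℕ (u ⊕ d)            ≡⟨ cong +_ (toℕ-fromℕ< _) ⟩
      + (a %ℕ n)               ≡⟨ remainder a (+ (a %ℕ n)) (a /ℕ n) (+ n) (a≡a%ℕn+[a/ℕn]*n a n) ⟩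
      a + - (a /ℕ n) * + n     ∎)
      where
      open ≡-Reasoning
      a : ℤ
      a = + toℕ u + d
      cancel : ∀ r q c → r ≡ r + q * c + - q * c
      cancel = solve-∀
      remainder : ∀ a r q c → a ≡ r + q * c → r ≡ a + - q * c
      remainder a r q c refl = cancel r q c

    ⊕-from-shift : ∀ {u d v} → Shift u d v → u ⊕ d ≡ v
    ⊕-from-shift {u} {d} = shift-target-unique (shift-⊕ u d)

    ⊕-assoc : ∀ u a b → u ⊕ a ⊕ b ≡ u ⊕ (a + b)
    ⊕-assoc u a b = sym (⊕-from-shift (shift-trans (shift-⊕ u a) (shift-⊕ (u ⊕ a) b)))

    ⊕-identityʳ : ∀ u → u ⊕ 0ℤ ≡ u
    ⊕-identityʳ u = ⊕-from-shift shift-refl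

    ⊕-cancelˡ-near : ∀ u {a b} → ∣ a - b ∣ ℕ.< n → u ⊕ a ≡ u ⊕ b → a ≡ b
    ⊕-cancelˡ-near u {a} {b} lt eq =
      shift-offset-unique (shift-⊕ u a) (subst (Shift u b) (sym eq) (shift-⊕ u b)) lt

    ⊕-difference : ∀ {u v} a b → u ⊕ a ≡ v ⊕ b → u ⊕ (a - b) ≡ v
    ⊕-difference {u} {v} a b eq =
      ⊕-from-shift (shift-trans (shift-⊕ u a) (shift-sym (subst (Shift v b) (sym eq) (shift-⊕ v b))))

  module _ {m : ℕ} where

    shift-diff : ∀ (x y : Fin (suc m)) → Shift y (+ diff (suc m) x y) x
    shift-diff x y = shift (+ q - 1ℤ) (solve-for-x (+ toℕ x) (+ toℕ y) (+ n) (+ a) (+ r) (+ q) a≡x+[n-y] a≡r+qn)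
      where
      n a r q : ℕ
      n = suc m
      a = toℕ x ℕ.+ (n ℕ.∸ toℕ y)
      r = a % n
      q = a / n
      a≡x+[n-y] : + a ≡ + toℕ x + (+ n - + toℕ y)
      a≡x+[n-y] = trans (ℤP.pos-+ (toℕ x) (n ℕ.∸ toℕ y)) (cong (λ t → + toℕ x + t) (+[m∸n]≡+m-+n (ℕP.<⇒≤ (toℕ<n y))))
      a≡r+qn : + a ≡ + r + + q * + n
      a≡r+qn = trans (cong +_ (m≡m%n+[m/n]*n a n)) (trans (ℤP.pos-+ r (q ℕ.* n)) (cong (λ t → + r + t) (ℤP.pos-* q n)))
      solve-for-x : ∀ x y n a r q → a ≡ x + (n - y) → a ≡ r + q * n → x ≡ y + r + (q - 1ℤ) * n
      solve-for-x x y n a r q h h′ = begin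
        x                       ≡⟨ expand x y n ⟩
        (x + (n - y)) + y - n   ≡⟨ cong (λ t → t + y - n) (trans (sym h) h′) ⟩
        (r + q * n) + y - n     ≡⟨ regroup y r q n ⟩
        y + r + (q - 1ℤ) * n    ∎
        where
        open ≡-Reasoning
        expand : ∀ x y n → x ≡ (x + (n - y)) + y - n
        expand = solve-∀
        regroup : ∀ y r q n → (r + q * n) + y - n ≡ y + r + (q - 1ℤ) * n
        regroup = solve-∀

    diff-unique : ∀ {x y : Fin (suc m)} {e} → Shift y (+ e) x → e ℕ.< suc m → diff (suc m) x y ≡ e
    diff-unique {x} {y} sh e<n =
      ℤP.+-injective (shift-offset-unique (shift-diff x y) sh (∣+r-+e∣<n (m%n<n (toℕ x ℕ.+ (suc m ℕ.∸ toℕ y)) (suc m)) e<n))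

module ClosedNeighbourhood where
  open import Data.Nat as ℕ using (ℕ; suc; s≤s; z≤n)
  import Data.Nat.Properties as ℕP
  open import Data.Integer as ℤ using (ℤ; +_; 0ℤ; 1ℤ; -1ℤ; _+_; _*_; -_; _-_; ∣_∣)
  open import Data.Integer.Tactic.RingSolver using (solve-∀)
  open import Data.Fin using (Fin)
  open import Data.List using (List; []; _∷_; map; allFin)
  open import Data.List.Membership.Propositional using (_∈_)
  open import Data.List.Membership.Propositional.Properties using (∈-filter⁺; ∈-filter⁻; ∈-map⁺; ∈-map⁻; ∈-allFin)
  open import Data.List.Membership.Propositional.Properties.WithK using (unique∧set⇒bag)
  open import Data.List.Relation.Binary.BagAndSetEquality using (∼bag⇒↭)
  open import Data.List.Relation.Binary.Permutation.Propositional using (_↭_)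
  open import Data.List.Relation.Unary.Any using (here; there)
  open import Data.List.Relation.Unary.AllPairs as AllPairs using (AllPairs; allPairs?)
  import Data.List.Relation.Unary.AllPairs.Properties as AllPairs
  open import Data.List.Relation.Unary.Unique.Propositional using (Unique)
  import Data.List.Relation.Unary.Unique.Propositional.Properties as Unique
  open import Data.Product using (∃-syntax; _×_; _,_; proj₂)
  open import Data.Sum using (inj₁; inj₂)
  open import Function.Base using (_∘_)
  open import Function.Bundles using (mk⇔)
  open import Relation.Binary.PropositionalEquality
  open import Relation.Nullary using (¬?)
  open import Relation.Nullary.Decidable using (toWitness; _×-dec_)
  open import Defs using (diff; InClosedNbhd; inClosedNbhd?; nbhdList)
  open Cyclic

  closedNbhdOffsets : List ℤ
  closedNbhdOffsets = 0ℤ ∷ 1ℤ ∷ -1ℤ ∷ + 3 ∷ - + 3 ∷ []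

  offsets-near : AllPairs (λ a b → a ≢ b × ∣ a - b ∣ ℕ.≤ 6) closedNbhdOffsets
  offsets-near = toWitness {a? = allPairs? (λ a b → ¬? (a ℤ.≟ b) ×-dec (∣ a - b ∣ ℕ.≤? 6)) closedNbhdOffsets} _

  module _ {m : ℕ} (6≤m : 6 ℕ.≤ m) where
    private
      n = suc m

    -- Defs reads x ∈ N[y] off the residue diff n x y ∈ {0, 1, n ∸ 1, 3, n ∸ 3}; j relates a residue e to its offset d.
    residue⇒shift : ∀ {x y : Fin n} {d e} j → + e ≡ d + j * + n → diff n x y ≡ e → Shift y d x
    residue⇒shift {x} {y} {d} {e} j e≡ refl =
      subst (λ c → Shift y c x) (trans (cong (_+ - j * + n) e≡) (cancel d j (+ n))) (shift-add-period (- j) (shift-diff x y))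
      where
      cancel : ∀ d j c → d + j * c + - j * c ≡ d
      cancel = solve-∀

    shift⇒residue : ∀ {x y : Fin n} {d e} j → + e ≡ d + j * + n → e ℕ.< n → Shift y d x → diff n x y ≡ e
    shift⇒residue {x} {y} j e≡ e<n sh = diff-unique (subst (λ c → Shift y c x) (sym e≡) (shift-add-period j sh)) e<n

    private
      wrap : ∀ k → k ℕ.≤ n → + (n ℕ.∸ k) ≡ - + k + 1ℤ * + n
      wrap k k≤n = trans (+[m∸n]≡+m-+n k≤n) (regroup (+ n) (+ k))
        where
        regroup : ∀ c k → c - k ≡ - k + 1ℤ * c
        regroup = solve-∀
      3<n : 3 ℕ.< n
      3<n = s≤s (ℕP.≤-trans (ℕP.≤ᵇ⇒≤ 3 6 _) 6≤m)

    inClosedNbhd⇒shift : ∀ {x y : Fin n} → InClosedNbhd n x y → ∃[ d ] d ∈ closedNbhdOffsets × Shift y d x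
    inClosedNbhd⇒shift (inj₁ eq)                         = _ , here refl , residue⇒shift 0ℤ refl eq
    inClosedNbhd⇒shift (inj₂ (inj₁ eq))                  = _ , there (here refl) , residue⇒shift 0ℤ refl eq
    inClosedNbhd⇒shift (inj₂ (inj₂ (inj₁ eq)))           = _ , there (there (here refl)) , residue⇒shift 1ℤ (wrap 1 (s≤s z≤n)) eq
    inClosedNbhd⇒shift (inj₂ (inj₂ (inj₂ (inj₁ eq))))    = _ , there (there (there (here refl))) , residue⇒shift 0ℤ refl eq
    inClosedNbhd⇒shift (inj₂ (inj₂ (inj₂ (inj₂ eq))))    = _ , there (there (there (there (here refl)))) , residue⇒shift 1ℤ (wrap 3 (ℕP.<⇒≤ 3<n)) eq

    shift⇒inClosedNbhd : ∀ {x y : Fin n} {d} → d ∈ closedNbhdOffsets → Shift y d x → InClosedNbhd n x y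
    shift⇒inClosedNbhd (here refl) sh =
      inj₁ (shift⇒residue 0ℤ refl (s≤s z≤n) sh)
    shift⇒inClosedNbhd (there (here refl)) sh =
      inj₂ (inj₁ (shift⇒residue 0ℤ refl (ℕP.<-trans (s≤s (s≤s z≤n)) 3<n) sh))
    shift⇒inClosedNbhd (there (there (here refl))) sh =
      inj₂ (inj₂ (inj₁ (shift⇒residue 1ℤ (wrap 1 (s≤s z≤n)) (ℕP.n<1+n m) sh)))
    shift⇒inClosedNbhd (there (there (there (here refl)))) sh =
      inj₂ (inj₂ (inj₂ (inj₁ (shift⇒residue 0ℤ refl 3<n sh))))
    shift⇒inClosedNbhd (there (there (there (there (here refl))))) sh =
      inj₂ (inj₂ (inj₂ (inj₂ (shift⇒residue 1ℤ (wrap 3 (ℕP.<⇒≤ 3<n)) (s≤s (ℕP.m∸n≤m m 2)) sh))))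

    nbhdList-↭ : ∀ (y : Fin n) → nbhdList y ↭ map (y ⊕_) closedNbhdOffsets
    nbhdList-↭ y = ∼bag⇒↭ (unique∧set⇒bag nbhdList-unique offsets-unique (mk⇔ to from))
      where
      nbhdList-unique : Unique (nbhdList y)
      nbhdList-unique = Unique.filter⁺ (λ x → inClosedNbhd? n x y) (Unique.allFin⁺ n)
      offsets-unique : Unique (map (y ⊕_) closedNbhdOffsets)
      offsets-unique = AllPairs.map⁺ (AllPairs.map (λ (a≢b , ∣a-b∣≤6) → a≢b ∘ ⊕-cancelˡ-near y (s≤s (ℕP.≤-trans ∣a-b∣≤6 6≤m))) offsets-near)
      to : ∀ {x} → x ∈ nbhdList y → x ∈ map (y ⊕_) closedNbhdOffsets
      to x∈ with inClosedNbhd⇒shift (proj₂ (∈-filter⁻ (λ x → inClosedNbhd? n x y) {xs = allFin n} x∈))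
      ... | d , d∈ , sh = subst (_∈ map (y ⊕_) closedNbhdOffsets) (⊕-from-shift sh) (∈-map⁺ (y ⊕_) d∈)
      from : ∀ {x} → x ∈ map (y ⊕_) closedNbhdOffsets → x ∈ nbhdList y
      from x∈ with ∈-map⁻ (y ⊕_) x∈
      ... | d , d∈ , refl = ∈-filter⁺ (λ x → inClosedNbhd? n x y) (∈-allFin (y ⊕ d)) (shift⇒inClosedNbhd d∈ (shift-⊕ y d))

module LocalView where
  open import Data.Nat as ℕ using (ℕ; suc)
  import Data.Nat.Properties as ℕP
  open import Data.Nat.ListAction using (sum)
  open import Data.Nat.ListAction.Properties using (sum-↭)
  open import Data.Integer using (ℤ; _+_)
  open import Data.Rational as ℚ using (ℚ; 0ℚ)
  import Data.Rational.Properties as ℚP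
  open import Data.Bool using (Bool; true; false; _∧_)
  open import Data.Fin using (Fin)
  open import Data.Fin.Subset using (Subset; ∣_∣)
  open import Data.Vec as Vec using (_∷_; lookup)
  import Data.Vec.Properties as Vec
  open import Data.List as List using (List; map; filter; allFin; foldr; tabulate; concatMap)
  import Data.List.Properties as List
  open import Data.List.Relation.Binary.Permutation.Propositional using (_↭_; ↭⇒↭ₛ; ↭-trans; ↭-sym)
  open import Data.List.Relation.Binary.Permutation.Propositional.Properties using (map⁺)
  open import Data.List.Relation.Binary.Permutation.Setoid.Properties using (foldr-commMonoid)
  open import Data.List.Relation.Binary.Pointwise using (Pointwise-≡⇒≡)
  open import Data.List.Relation.Unary.All as All using (All)
  import Data.List.Relation.Unary.All.Properties as All
  import Data.List.Sort.InsertionSort.Base as InsertionSort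
  import Data.List.Sort.InsertionSort.Properties as InsertionSort
  import Data.List.Relation.Unary.Sorted.TotalOrder.Properties as Sorted
  open import Algebra.Bundles using (CommutativeMonoid)
  open import Relation.Binary.Core using (_Preserves_⟶_)
  open import Function.Base using (_∘_; id)
  open import Relation.Binary.PropositionalEquality
  open import Relation.Nullary.Decidable using (Dec; yes; no; ⌊_⌋)
  open import Defs using (N[_]; shadow; share; profile; recip; inClosedNbhd?; nbhdList)
  open Cyclic
  open ClosedNeighbourhood

  bit : Bool → ℕ
  bit true  = 1
  bit false = 0

  sumℚ : List ℚ → ℚ
  sumℚ = foldr ℚ._+_ 0ℚ

  sumℚ-↭ : sumℚ Preserves _↭_ ⟶ _≡_
  sumℚ-↭ p = foldr-commMonoid +-0.setoid +-0.isCommutativeMonoid (↭⇒↭ₛ p)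
    where module +-0 = CommutativeMonoid ℚP.+-0-commutativeMonoid

  sortℕ : List ℕ → List ℕ
  sortℕ = InsertionSort.sort ℕP.≤-decTotalOrder

  sortℕ-↭ : sortℕ Preserves _↭_ ⟶ _≡_
  sortℕ-↭ {xs} {ys} p = Pointwise-≡⇒≡ (Sorted.↗↭↗⇒≋ ℕP.≤-totalOrder
    (InsertionSort.sort-↗ ℕP.≤-decTotalOrder xs) (InsertionSort.sort-↗ ℕP.≤-decTotalOrder ys)
    (↭⇒↭ₛ (↭-trans (InsertionSort.sort-↭ ℕP.≤-decTotalOrder xs) (↭-trans p (↭-sym (InsertionSort.sort-↭ ℕP.≤-decTotalOrder ys))))))

  ∣p∣≡sum-bits : ∀ {n} (p : Subset n) → ∣ p ∣ ≡ sum (tabulate (bit ∘ lookup p))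
  ∣p∣≡sum-bits Vec.[]      = refl
  ∣p∣≡sum-bits (true ∷ p)  = cong suc (∣p∣≡sum-bits p)
  ∣p∣≡sum-bits (false ∷ p) = ∣p∣≡sum-bits p

  sum-bits-filter : ∀ {A : Set} {P : A → Set} (P? : ∀ x → Dec (P x)) (g : A → Bool) xs →
    sum (map (λ x → bit (⌊ P? x ⌋ ∧ g x)) xs) ≡ sum (map (bit ∘ g) (filter P? xs))
  sum-bits-filter P? g List.[] = refl
  sum-bits-filter P? g (x List.∷ xs) with P? x
  ... | yes _ = cong (bit (g x) ℕ.+_) (sum-bits-filter P? g xs)
  ... | no  _ = sum-bits-filter P? g xs

  -- z ↦ [u + z ∈ S] for a fixed vertex u: the code as seen from u, unrolled to ℤ
  Pattern : Set
  Pattern = ℤ → Bool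

  shadowSizeAt : Pattern → ℤ → ℕ
  shadowSizeAt b x = sum (map (λ d → bit (b (x + d))) closedNbhdOffsets)

  shareAt : Pattern → ℤ → ℚ
  shareAt b x = sumℚ (map (λ d → recip (shadowSizeAt b (x + d))) closedNbhdOffsets)

  profileAt : Pattern → ℤ → List ℕ
  profileAt b x = sortℕ (map (λ d → shadowSizeAt b (x + d)) closedNbhdOffsets)

  infix 4 _≐_on_
  _≐_on_ : Pattern → Pattern → List ℤ → Set
  b ≐ c on R = All (λ z → b z ≡ c z) R

  twoStepBall : ℤ → List ℤ
  twoStepBall x = concatMap (λ d → map (λ e → x + d + e) closedNbhdOffsets) closedNbhdOffsets

  shadowSizeAt-cong : ∀ {b c x} → b ≐ c on map (x +_) closedNbhdOffsets → shadowSizeAt b x ≡ shadowSizeAt c x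
  shadowSizeAt-cong {x = x} b≐c = cong sum (List.map-cong-local (All.map (cong bit) (All.map⁻ {f = x +_} b≐c)))

  private
    shadowSizes-cong : ∀ {b c x} → b ≐ c on twoStepBall x →
      All (λ d → shadowSizeAt b (x + d) ≡ shadowSizeAt c (x + d)) closedNbhdOffsets
    shadowSizes-cong {x = x} b≐c = All.map (λ {d} → shadowSizeAt-cong {x = x + d}) (All.map⁻ {f = λ d → map (λ e → x + d + e) closedNbhdOffsets} (All.concat⁻ b≐c))

  shareAt-cong : ∀ {b c x} → b ≐ c on twoStepBall x → shareAt b x ≡ shareAt c x
  shareAt-cong {b} {c} {x} b≐c = cong sumℚ (List.map-cong-local (All.map (cong recip) (shadowSizes-cong {b} {c} {x} b≐c)))

  profileAt-cong : ∀ {b c x} → b ≐ c on twoStepBall x → profileAt b x ≡ profileAt c x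
  profileAt-cong {b} {c} {x} b≐c = cong sortℕ (List.map-cong-local (shadowSizes-cong {b} {c} {x} b≐c))

  module _ {m : ℕ} (6≤m : 6 ℕ.≤ m) where
    private
      n = suc m

    ∣shadow∣≡sum-offsets : ∀ (S : Subset n) w → ∣ shadow S w ∣ ≡ sum (map (λ d → bit (lookup S (w ⊕ d))) closedNbhdOffsets)
    ∣shadow∣≡sum-offsets S w = begin
      ∣ shadow S w ∣                                                ≡⟨ ∣p∣≡sum-bits (shadow S w) ⟩
      sum (tabulate (bit ∘ lookup (shadow S w)))                    ≡⟨ cong sum (List.map-tabulate id (bit ∘ lookup (shadow S w))) ⟨
      sum (map (bit ∘ lookup (shadow S w)) (allFin n))              ≡⟨ cong sum (List.map-cong lookup-shadow (allFin n)) ⟩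
      sum (map (λ i → bit (⌊ inClosedNbhd? n i w ⌋ ∧ lookup S i)) (allFin n)) ≡⟨ sum-bits-filter (λ i → inClosedNbhd? n i w) (lookup S) (allFin n) ⟩
      sum (map (bit ∘ lookup S) (nbhdList w))                       ≡⟨ sum-↭ (map⁺ (bit ∘ lookup S) (nbhdList-↭ 6≤m w)) ⟩
      sum (map (bit ∘ lookup S) (map (w ⊕_) closedNbhdOffsets))     ≡⟨ cong sum (List.map-∘ {g = bit ∘ lookup S} {f = w ⊕_} closedNbhdOffsets) ⟨
      sum (map (λ d → bit (lookup S (w ⊕ d))) closedNbhdOffsets)    ∎
      where
      open ≡-Reasoning
      lookup-shadow : ∀ i → bit (lookup (shadow S w) i) ≡ bit (⌊ inClosedNbhd? n i w ⌋ ∧ lookup S i)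
      lookup-shadow i = cong bit (trans (Vec.lookup-zipWith _∧_ i N[ w ] S)
        (cong (_∧ lookup S i) (Vec.lookup∘tabulate (λ x → ⌊ inClosedNbhd? n x w ⌋) i)))

    view : Subset n → Fin n → Pattern
    view S u z = lookup S (u ⊕ z)

    ∣shadow∣≡shadowSizeAt : ∀ S u x → ∣ shadow S (u ⊕ x) ∣ ≡ shadowSizeAt (view S u) x
    ∣shadow∣≡shadowSizeAt S u x = trans (∣shadow∣≡sum-offsets S (u ⊕ x))
      (cong sum (List.map-cong (λ d → cong (bit ∘ lookup S) (⊕-assoc u x d)) closedNbhdOffsets))

    private
      shadowSizes : ∀ S u x → (λ d → ∣ shadow S (u ⊕ x ⊕ d) ∣) ≗ (λ d → shadowSizeAt (view S u) (x + d))
      shadowSizes S u x d = trans (cong (λ w → ∣ shadow S w ∣) (⊕-assoc u x d)) (∣shadow∣≡shadowSizeAt S u (x + d))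

    share≡shareAt : ∀ S u x → share S (u ⊕ x) ≡ shareAt (view S u) x
    share≡shareAt S u x = begin
      share S w                                                            ≡⟨ List.foldr-map ℚ._+_ size 0ℚ (nbhdList w) ⟨
      sumℚ (map size (nbhdList w))                                         ≡⟨ sumℚ-↭ (map⁺ size (nbhdList-↭ 6≤m w)) ⟩
      sumℚ (map size (map (w ⊕_) closedNbhdOffsets))                       ≡⟨ cong sumℚ (List.map-∘ {g = size} {f = w ⊕_} closedNbhdOffsets) ⟨
      sumℚ (map (λ d → recip ∣ shadow S (w ⊕ d) ∣) closedNbhdOffsets)      ≡⟨ cong sumℚ (List.map-cong (cong recip ∘ shadowSizes S u x) closedNbhdOffsets) ⟩
      shareAt (view S u) x                                                 ∎
      where
      open ≡-Reasoning
      w = u ⊕ x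
      size = λ y → recip ∣ shadow S y ∣

    profile≡profileAt : ∀ S u x → profile S (u ⊕ x) ≡ profileAt (view S u) x
    profile≡profileAt S u x = begin
      profile S w                                                      ≡⟨ sortℕ-↭ (map⁺ size (nbhdList-↭ 6≤m w)) ⟩
      sortℕ (map size (map (w ⊕_) closedNbhdOffsets))                  ≡⟨ cong sortℕ (List.map-∘ {g = size} {f = w ⊕_} closedNbhdOffsets) ⟨
      sortℕ (map (λ d → ∣ shadow S (w ⊕ d) ∣) closedNbhdOffsets)       ≡⟨ cong sortℕ (List.map-cong (shadowSizes S u x) closedNbhdOffsets) ⟩
      profileAt (view S u) x                                           ∎
      where
      open ≡-Reasoning
      w = u ⊕ x
      size = λ y → ∣ shadow S y ∣

module Locating where
  open import Data.Nat as ℕ using (ℕ; suc)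
  import Data.Nat.Properties as ℕP
  open import Data.Integer as ℤ using (ℤ; _+_; _-_; ∣_∣)
  open import Data.Integer.Tactic.RingSolver using (solve-∀)
  open import Data.Bool using (Bool; true; false; _∧_; _∨_; not; T)
  open import Data.Bool.Properties using (T-∧; T-∨; T-≡)
  open import Data.Unit using (tt)
  open import Data.Fin using (Fin)
  open import Data.Fin.Subset as Subset using (Subset; _∈_; _∉_; _⊆_; Nonempty)
  open import Data.Fin.Subset.Properties using (x∈p∩q⁺; x∈p∩q⁻; ⊆-antisym; p⊆q⇒∣p∣≤∣q∣; ∣⁅x⁆∣≡1; x∈⁅y⁆⇒x≡y)
  open import Data.Vec using (lookup)
  open import Data.Vec.Properties using ([]=⇒lookup; lookup⇒[]=; lookup∘tabulate)
  open import Data.List using (List)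
  import Data.List.Membership.Propositional as List
  open import Data.Bool.ListAction using (all)
  open import Data.List.Membership.DecPropositional ℤ._≟_ using (_∈?_)
  open import Data.List.Relation.Unary.All as All using (All)
  open import Data.List.Relation.Unary.All.Properties using (all⁺; all⁻)
  open import Data.Product using (∃-syntax; _×_; _,_; proj₁; proj₂)
  open import Data.Sum using (inj₁; inj₂)
  open import Function.Base using (_∘_; id)
  open import Function.Bundles using (Equivalence)
  open import Relation.Binary.PropositionalEquality
  open import Relation.Nullary using (contradiction; yes; no)
  open import Relation.Nullary.Decidable using (⌊_⌋; toWitness; fromWitness)
  open import Defs using (N[_]; shadow; inClosedNbhd?; InClosedNbhd; IsLocatingCode)
  open Cyclic
  open ClosedNeighbourhood
  open LocalView

  shadowIncludedAt : Pattern → ℤ → ℤ → Bool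
  shadowIncludedAt b x y = all (λ d → not (b (x + d)) ∨ ⌊ x + d - y ∈? closedNbhdOffsets ⌋) closedNbhdOffsets

  sameShadowAt : Pattern → ℤ → ℤ → Bool
  sameShadowAt b x y = shadowIncludedAt b x y ∧ shadowIncludedAt b y x

  locatingAt : Pattern → List ℤ → Bool
  locatingAt b R = all (λ x → b x ∨ (0 ℕ.<ᵇ shadowSizeAt b x)) R
                 ∧ all (λ x → all (λ y → ⌊ x ℤ.≟ y ⌋ ∨ b x ∨ b y ∨ not (sameShadowAt b x y)) R) R

  Nonempty⇒0<∣p∣ : ∀ {n} {p : Subset n} → Nonempty p → 0 ℕ.< Subset.∣ p ∣
  Nonempty⇒0<∣p∣ {p = p} (x , x∈p) =
    subst (ℕ._≤ Subset.∣ p ∣) (∣⁅x⁆∣≡1 x) (p⊆q⇒∣p∣≤∣q∣ λ y∈⁅x⁆ → subst (_∈ p) (sym (x∈⁅y⁆⇒x≡y x y∈⁅x⁆)) x∈p)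

  module _ {n : ℕ} where

    ∈N[]⇒inClosedNbhd : ∀ {t w : Fin n} → t ∈ N[ w ] → InClosedNbhd n t w
    ∈N[]⇒inClosedNbhd {t} {w} t∈ =
      toWitness (Equivalence.from T-≡ (trans (sym (lookup∘tabulate (λ x → ⌊ inClosedNbhd? n x w ⌋) t)) ([]=⇒lookup t∈)))

    inClosedNbhd⇒∈N[] : ∀ {t w : Fin n} → InClosedNbhd n t w → t ∈ N[ w ]
    inClosedNbhd⇒∈N[] {t} {w} p =
      lookup⇒[]= t N[ w ] (trans (lookup∘tabulate (λ x → ⌊ inClosedNbhd? n x w ⌋) t) (Equivalence.to T-≡ (fromWitness p)))

  module _ {m : ℕ} (6≤m : 6 ℕ.≤ m) where
    private
      n = suc m

    module _ (S : Subset n) (u : Fin n) where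

      shadowIncludedAt-sound : ∀ x y → T (shadowIncludedAt (view 6≤m S u) x y) → shadow S (u ⊕ x) ⊆ shadow S (u ⊕ y)
      shadowIncludedAt-sound x y incl {t} t∈ = x∈p∩q⁺ (inClosedNbhd⇒∈N[] {w = u ⊕ y} t∈N[u⊕y] , t∈S)
        where
        t∈S : t ∈ S
        t∈S = proj₂ (x∈p∩q⁻ N[ u ⊕ x ] S t∈)
        witness : ∃[ d ] d List.∈ closedNbhdOffsets × Shift (u ⊕ x) d t
        witness = inClosedNbhd⇒shift 6≤m (∈N[]⇒inClosedNbhd {w = u ⊕ x} (proj₁ (x∈p∩q⁻ N[ u ⊕ x ] S t∈)))
        d : ℤ
        d = proj₁ witness
        u⊕[x+d]≡t : u ⊕ (x + d) ≡ t
        u⊕[x+d]≡t = trans (sym (⊕-assoc u x d)) (⊕-from-shift (proj₂ (proj₂ witness)))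
        t-offset : T (not (view 6≤m S u (x + d)) ∨ ⌊ x + d - y ∈? closedNbhdOffsets ⌋)
        t-offset = All.lookup (all⁺ (λ d → not (view 6≤m S u (x + d)) ∨ ⌊ x + d - y ∈? closedNbhdOffsets ⌋) closedNbhdOffsets incl) (proj₁ (proj₂ witness))
        u⊕y⊕[x+d-y]≡t : u ⊕ y ⊕ (x + d - y) ≡ t
        u⊕y⊕[x+d-y]≡t = trans (⊕-assoc u y (x + d - y)) (trans (cong (u ⊕_) (regroup y (x + d))) u⊕[x+d]≡t)
          where
          regroup : ∀ y z → y + (z - y) ≡ z
          regroup = solve-∀
        t∈N[u⊕y] : InClosedNbhd n t (u ⊕ y)
        t∈N[u⊕y] with Equivalence.to T-∨ t-offset
        ... | inj₁ t∉S = contradiction (subst (T ∘ not) (trans (cong (lookup S) u⊕[x+d]≡t) ([]=⇒lookup t∈S)) t∉S) id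
        ... | inj₂ offset = shift⇒inClosedNbhd 6≤m {x = t} {y = u ⊕ y} (toWitness offset)
                              (subst (Shift (u ⊕ y) (x + d - y)) u⊕y⊕[x+d-y]≡t (shift-⊕ (u ⊕ y) (x + d - y)))

      lookup≡false⇒∉ : ∀ {w} → lookup S w ≡ false → w ∉ S
      lookup≡false⇒∉ w∉S w∈S = contradiction (trans (sym ([]=⇒lookup w∈S)) w∉S) λ ()

      sameShadowAt-sound : ∀ x y → T (sameShadowAt (view 6≤m S u) x y) → shadow S (u ⊕ x) ≡ shadow S (u ⊕ y)
      sameShadowAt-sound x y same with Equivalence.to T-∧ same
      ... | x⊆y , y⊆x = ⊆-antisym (shadowIncludedAt-sound x y x⊆y) (shadowIncludedAt-sound y x y⊆x)

      locatingAt-view : IsLocatingCode S → ∀ {R} → All (λ x → All (λ y → ∣ x - y ∣ ℕ.< n) R) R →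
        T (locatingAt (view 6≤m S u) R)
      locatingAt-view (nonempty , distinct) {R} near = Equivalence.from T-∧
        ( all⁻ (λ x → b x ∨ (0 ℕ.<ᵇ shadowSizeAt b x)) (All.tabulate {xs = R} λ {x} _ → covered x)
        , all⁻ _ (All.map (λ {x} → all⁻ _ ∘ All.map (λ {y} → separated x y)) near))
        where
        b : Pattern
        b = view 6≤m S u
        covered : ∀ x → T (b x ∨ (0 ℕ.<ᵇ shadowSizeAt b x))
        covered x with b x in u⊕x∈S?
        ... | true  = tt
        ... | false = ℕP.<⇒<ᵇ (subst (0 ℕ.<_) (∣shadow∣≡shadowSizeAt 6≤m S u x)
                        (Nonempty⇒0<∣p∣ (nonempty (u ⊕ x) (lookup≡false⇒∉ u⊕x∈S?))))
        separated : ∀ x y → ∣ x - y ∣ ℕ.< n → T (⌊ x ℤ.≟ y ⌋ ∨ b x ∨ b y ∨ not (sameShadowAt b x y))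
        separated x y lt with x ℤ.≟ y | b x in u⊕x∈S? | b y in u⊕y∈S? | sameShadowAt b x y in same
        ... | yes _   | _     | _     | _     = tt
        ... | no _    | true  | _     | _     = tt
        ... | no _    | false | true  | _     = tt
        ... | no _    | false | false | false = tt
        ... | no x≢y  | false | false | true  =
          distinct (u ⊕ x) (u ⊕ y) (lookup≡false⇒∉ u⊕x∈S?) (lookup≡false⇒∉ u⊕y∈S?)
            (x≢y ∘ ⊕-cancelˡ-near u lt) (sameShadowAt-sound x y (Equivalence.from T-≡ same))

module Search where
  open import Data.Nat as ℕ using (ℕ; zero; suc)
  open import Data.Integer as ℤ using (ℤ; +_; -[1+_]; 0ℤ; _+_; _-_; -_; ∣_∣)
  open import Data.Integer.Tactic.RingSolver using (solve-∀)
  open import Data.Rational as ℚ using (_/_)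
  import Data.Rational.Properties as ℚP
  open import Data.Bool as Bool using (Bool; true; false; _∧_; _∨_; not; T)
  open import Data.Bool.ListAction using (all; any)
  open import Data.Fin using (Fin; toℕ; fromℕ<)
  open import Data.Fin.Properties using (toℕ-fromℕ<; any?; all?)
  open import Data.Vec as Vec using (Vec; []; _∷_; tabulate; lookup)
  import Data.Vec.Properties as Vec
  open import Data.List as List using (List; applyUpTo; allFin)
  import Data.List.Properties as List
  open import Data.List.Membership.DecPropositional ℤ._≟_ using (_∈?_)
  import Data.List.Membership.Propositional as List
  open import Data.List.Membership.Propositional using (find)
  open import Data.List.Relation.Unary.Any.Properties using (any⁻)
  open import Data.List.Relation.Binary.Subset.DecPropositional ℤ._≟_ using (_⊆_; _⊆?_)
  open import Data.List.Membership.Propositional.Properties using (∈-allFin)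
  open import Data.List.Relation.Unary.All as All using (All)
  open import Data.List.Relation.Unary.All.Properties using (applyUpTo⁺₁)
  open import Data.List.Relation.Unary.Any using (here; there)
  import Data.Product
  open import Data.Product using (∃-syntax; _×_; _,_; proj₁; proj₂)
  open import Data.Bool.Properties using (T-∧; T-∨; T-≡; ∧-conicalˡ; ∧-conicalʳ)
  import Data.Sum
  open import Data.Sum using (_⊎_)
  open import Function.Bundles using (Equivalence)
  open import Relation.Binary.PropositionalEquality
  open import Relation.Nullary using (¬_)
  open import Data.Empty using (⊥-elim)
  open import Relation.Nullary.Decidable using (Dec; ⌊_⌋; toWitness; toWitnessFalse)
  open import Function.Base using (_∘_)
  open LocalView
  open Locating

  pick : ∀ {k} → Vec Bool k → ℕ → Bool
  pick []       _       = false
  pick (x ∷ _)  zero    = x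
  pick (_ ∷ xs) (suc i) = pick xs i

  pick-tabulate : ∀ {k} (f : Fin k → Bool) {i} (i<k : i ℕ.< k) → pick (tabulate f) i ≡ f (fromℕ< i<k)
  pick-tabulate {suc k} f {zero}  _              = refl
  pick-tabulate {suc k} f {suc i} (ℕ.s≤s i<k) = pick-tabulate (f ∘ Fin.suc) i<k

  pickℤ : ∀ {k} → Vec Bool k → ℤ → Bool
  pickℤ v (+ i)     = pick v i
  pickℤ v -[1+ _ ]  = false

  window : ∀ {k} → ℕ → Vec Bool k → Pattern
  window r v z = pickℤ v (z + + r)

  sample : ∀ r → Pattern → Vec Bool (suc (r ℕ.+ r))
  sample r b = tabulate λ i → b (+ toℕ i - + r)

  centred : ℕ → List ℤ
  centred r = applyUpTo (λ i → + i - + r) (suc (r ℕ.+ r))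

  window-sample : ∀ r b → window r (sample r b) ≐ b on centred r
  window-sample r b = applyUpTo⁺₁ (λ i → + i - + r) (suc (r ℕ.+ r)) λ {i} i<k → begin
    window r (sample r b) (+ i - + r)   ≡⟨ cong (pickℤ (sample r b)) (cancel (+ i) (+ r)) ⟩
    pick (sample r b) i                 ≡⟨ pick-tabulate (λ j → b (+ toℕ j - + r)) i<k ⟩
    b (+ toℕ (fromℕ< i<k) - + r)        ≡⟨ cong (λ j → b (+ j - + r)) (toℕ-fromℕ< i<k) ⟩
    b (+ i - + r)                       ∎
    where
    open ≡-Reasoning
    cancel : ∀ i r → i - r + r ≡ i
    cancel = solve-∀

  allVec : ∀ k → (Vec Bool k → Bool) → Bool
  allVec zero    f = f []
  allVec (suc k) f = allVec k (f ∘ (true ∷_)) ∧ allVec k (f ∘ (false ∷_))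

  fromBits : ∀ {k} → Vec ℕ k → Vec Bool k
  fromBits = Vec.map (ℕ._≡ᵇ 1)

  -- The six possible windows S ∩ [u − 6, u + 6] of a heavy codeword u, and the offsets of their mates.
  heavyWindows : Vec (Vec Bool 13) 6
  heavyWindows =
      fromBits (1 ∷ 0 ∷ 1 ∷ 0 ∷ 1 ∷ 0 ∷ 1 ∷ 0 ∷ 0 ∷ 0 ∷ 0 ∷ 1 ∷ 0 ∷ [])
    ∷ fromBits (1 ∷ 1 ∷ 1 ∷ 0 ∷ 1 ∷ 0 ∷ 1 ∷ 0 ∷ 0 ∷ 0 ∷ 0 ∷ 1 ∷ 0 ∷ [])
    ∷ fromBits (0 ∷ 1 ∷ 0 ∷ 0 ∷ 0 ∷ 0 ∷ 1 ∷ 0 ∷ 1 ∷ 0 ∷ 1 ∷ 0 ∷ 1 ∷ [])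
    ∷ fromBits (1 ∷ 1 ∷ 1 ∷ 0 ∷ 0 ∷ 0 ∷ 1 ∷ 0 ∷ 0 ∷ 0 ∷ 0 ∷ 1 ∷ 1 ∷ [])
    ∷ fromBits (1 ∷ 1 ∷ 0 ∷ 0 ∷ 0 ∷ 0 ∷ 1 ∷ 0 ∷ 0 ∷ 0 ∷ 1 ∷ 1 ∷ 1 ∷ [])
    ∷ fromBits (0 ∷ 1 ∷ 0 ∷ 0 ∷ 0 ∷ 0 ∷ 1 ∷ 0 ∷ 1 ∷ 0 ∷ 1 ∷ 1 ∷ 1 ∷ [])
    ∷ []

  mateOffsets : Vec ℤ 6
  mateOffsets = - + 2 ∷ - + 2 ∷ + 2 ∷ - + 4 ∷ + 4 ∷ + 2 ∷ []

  heavyWindowOf? : (v : Vec Bool 13) → Dec (∃[ i ] v ≡ lookup heavyWindows i)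
  heavyWindowOf? v = any? λ i → Vec.≡-dec Bool._≟_ v (lookup heavyWindows i)

  heavyAt : Pattern → Bool
  heavyAt b = ⌊ + 3 / 1 ℚP.<? shareAt b 0ℤ ⌋

  heavyProfile₁ heavyProfile₂ : List ℕ
  heavyProfile₁ = 1 List.∷ 1 List.∷ 2 List.∷ 2 List.∷ 3 List.∷ List.[]
  heavyProfile₂ = 1 List.∷ 1 List.∷ 2 List.∷ 3 List.∷ 4 List.∷ List.[]

  isHeavyProfile : List ℕ → Bool
  isHeavyProfile p = ⌊ List.≡-dec ℕ._≟_ p heavyProfile₁ ⌋ ∨ ⌊ List.≡-dec ℕ._≟_ p heavyProfile₂ ⌋

  isHeavyProfile-sound : ∀ p → T (isHeavyProfile p) → p ≡ heavyProfile₁ ⊎ p ≡ heavyProfile₂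
  isHeavyProfile-sound p h = Data.Sum.map (toWitness {a? = List.≡-dec ℕ._≟_ p heavyProfile₁})
    (toWitness {a? = List.≡-dec ℕ._≟_ p heavyProfile₂}) (Equivalence.to (T-∨ {⌊ List.≡-dec ℕ._≟_ p heavyProfile₁ ⌋}) h)

  heavyCodewordAt : Pattern → Bool
  heavyCodewordAt b = b 0ℤ ∧ heavyAt b ∧ locatingAt b (centred 3)

  classifies : Vec Bool 13 → Bool
  classifies v = not (heavyCodewordAt (window 6 v)) ∨ (⌊ heavyWindowOf? v ⌋ ∧ isHeavyProfile (profileAt (window 6 v) 0ℤ))

  classification : allVec 13 classifies ≡ true
  classification = refl

  widen : Vec Bool 13 → Vec Bool 8 → Vec Bool 21
  widen v (a₁ ∷ a₂ ∷ a₃ ∷ a₄ ∷ b₁ ∷ b₂ ∷ b₃ ∷ b₄ ∷ []) = a₁ ∷ a₂ ∷ a₃ ∷ a₄ ∷ v Vec.++ (b₁ ∷ b₂ ∷ b₃ ∷ b₄ ∷ [])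

  mateShares? : ∀ i (w : Vec Bool 21) → Dec (shareAt (window 10 w) 0ℤ ℚ.+ shareAt (window 10 w) (lookup mateOffsets i) ℚ.≤ + 6 / 1)
  mateShares? i w = shareAt (window 10 w) 0ℤ ℚ.+ shareAt (window 10 w) (lookup mateOffsets i) ℚP.≤? + 6 / 1

  mateBoundOn : Fin 6 → Vec Bool 21 → Bool
  mateBoundOn i w = window 10 w (lookup mateOffsets i) ∧ ⌊ mateShares? i w ⌋

  mateBounds : all (λ i → allVec 8 (mateBoundOn i ∘ widen (lookup heavyWindows i))) (allFin 6) ≡ true
  mateBounds = refl

  mateShift : Fin 6 → Fin 6 → ℤ
  mateShift i j = lookup mateOffsets i - lookup mateOffsets j

  -- Windows i at u and j at u + k, where k = mateShift i j, disagree at the vertex u + k + x.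
  disagreeAt : Fin 6 → Fin 6 → ℤ → Bool
  disagreeAt i j x = ⌊ k + x ∈? centred 6 ⌋
                   ∧ not ⌊ window 6 (lookup heavyWindows j) x Bool.≟ window 6 (lookup heavyWindows i) (k + x) ⌋
    where
    k : ℤ
    k = mateShift i j

  separatedMates : Fin 6 → Fin 6 → Bool
  separatedMates i j = ⌊ mateShift i j ℤ.≟ 0ℤ ⌋ ∨ any (disagreeAt i j) (centred 6)

  mateSeparation : all (λ i → all (separatedMates i) (allFin 6)) (allFin 6) ≡ true
  mateSeparation = refl

  allVec-sound : ∀ k f → allVec k f ≡ true → ∀ v → f v ≡ true
  allVec-sound zero    f h []          = h
  allVec-sound (suc k) f h (true ∷ v)  = allVec-sound k (f ∘ (true ∷_)) (∧-conicalˡ _ _ h) v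
  allVec-sound (suc k) f h (false ∷ v) = allVec-sound k (f ∘ (false ∷_)) (∧-conicalʳ _ _ h) v

  all-sound : ∀ {A : Set} (p : A → Bool) xs → all p xs ≡ true → ∀ {x} → x List.∈ xs → p x ≡ true
  all-sound p (x List.∷ xs) h (here refl) = ∧-conicalˡ _ _ h
  all-sound p (x List.∷ xs) h (there x∈)  = all-sound p xs (∧-conicalʳ (p x) _ h) x∈

  allFin-sound : ∀ {k} (p : Fin k → Bool) → all p (allFin k) ≡ true → ∀ i → p i ≡ true
  allFin-sound p h i = all-sound p (allFin _) h (∈-allFin i)

  -- Both sides read b only at literals in [−6, 6], where the window reduces to b by computation.
  locatingAt-window : ∀ b → locatingAt (window 6 (sample 6 b)) (centred 3) ≡ locatingAt b (centred 3)
  locatingAt-window b = refl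

  rim : Pattern → Vec Bool 8
  rim b = b (- + 10) ∷ b (- + 9) ∷ b (- + 8) ∷ b (- + 7) ∷ b (+ 7) ∷ b (+ 8) ∷ b (+ 9) ∷ b (+ 10) ∷ []

  sample-widen : ∀ b → sample 10 b ≡ widen (sample 6 b) (rim b)
  sample-widen b = refl

  centred3-near : All (λ x → All (λ y → ∣ x - y ∣ ℕ.≤ 6) (centred 3)) (centred 3)
  centred3-near = toWitness {a? = All.all? (λ x → All.all? (λ y → ∣ x - y ∣ ℕ.≤? 6) (centred 3)) (centred 3)} _

  twoStepBall-0⊆centred6 : twoStepBall 0ℤ ⊆ centred 6
  twoStepBall-0⊆centred6 = toWitness {a? = twoStepBall 0ℤ ⊆? centred 6} _

  twoStepBall-0⊆centred10 : twoStepBall 0ℤ ⊆ centred 10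
  twoStepBall-0⊆centred10 = toWitness {a? = twoStepBall 0ℤ ⊆? centred 10} _

  twoStepBall-mate⊆centred10 : ∀ i → twoStepBall (lookup mateOffsets i) ⊆ centred 10
  twoStepBall-mate⊆centred10 = toWitness {a? = all? λ i → twoStepBall (lookup mateOffsets i) ⊆? centred 10} _

  mateOffset∈centred10 : ∀ i → lookup mateOffsets i List.∈ centred 10
  mateOffset∈centred10 = toWitness {a? = all? λ i → lookup mateOffsets i ∈? centred 10} _

  T-not-∨ : ∀ {a c} → T (not a ∨ c) → T a → T c
  T-not-∨ {true} c _ = c

  classification-sound : ∀ v → T (window 6 v 0ℤ) → T (heavyAt (window 6 v)) → T (locatingAt (window 6 v) (centred 3)) →
    T ⌊ heavyWindowOf? v ⌋ × T (isHeavyProfile (profileAt (window 6 v) 0ℤ))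
  classification-sound v v₀ heavy locating =
    Equivalence.to (T-∧ {⌊ heavyWindowOf? v ⌋}) (T-not-∨ {heavyCodewordAt b} (Equivalence.from T-≡ (allVec-sound 13 classifies classification v))
      (Equivalence.from (T-∧ {b 0ℤ}) (v₀ , Equivalence.from (T-∧ {heavyAt b}) (heavy , locating))))
    where
    b : Pattern
    b = window 6 v

  MateBound : Fin 6 → Vec Bool 21 → Set
  MateBound i w = T (window 10 w (lookup mateOffsets i))
                × shareAt (window 10 w) 0ℤ ℚ.+ shareAt (window 10 w) (lookup mateOffsets i) ℚ.≤ + 6 / 1

  mateBound-sound : ∀ i e → MateBound i (widen (lookup heavyWindows i) e)
  mateBound-sound i e = Data.Product.map₂ (toWitness {a? = mateShares? i w})
    (Equivalence.to (T-∧ {window 10 w (lookup mateOffsets i)}) (Equivalence.from T-≡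
      (allVec-sound 8 (mateBoundOn i ∘ widen (lookup heavyWindows i))
        (allFin-sound (λ i → allVec 8 (mateBoundOn i ∘ widen (lookup heavyWindows i))) mateBounds i) e)))
    where
    w : Vec Bool 21
    w = widen (lookup heavyWindows i) e

  mateSeparation-at : ∀ i j → T (separatedMates i j)
  mateSeparation-at i j = Equivalence.from T-≡
    (allFin-sound (separatedMates i) (allFin-sound (λ i → all (separatedMates i) (allFin 6)) mateSeparation i) j)

  separatedMates-sound : ∀ i j {b : Pattern} →
    window 6 (lookup heavyWindows i) ≐ b on centred 6 →
    window 6 (lookup heavyWindows j) ≐ (λ x → b (mateShift i j + x)) on centred 6 →
    mateShift i j ≡ 0ℤ
  separatedMates-sound i j {b} agreeᵢ agreeⱼ =
    Data.Sum.[ toWitness , (λ disagreement → ⊥-elim (agree (find (any⁻ (disagreeAt i j) (centred 6) disagreement)))) ]′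
      (Equivalence.to (T-∨ {⌊ mateShift i j ℤ.≟ 0ℤ ⌋} {any (disagreeAt i j) (centred 6)}) (mateSeparation-at i j))
    where
    agree : ¬ (∃[ x ] x List.∈ centred 6 × T (disagreeAt i j x))
    agree (x , x∈ , disagree) = toWitnessFalse (proj₂ split)
      (trans (All.lookup agreeⱼ x∈) (sym (All.lookup agreeᵢ (toWitness (proj₁ split)))))
      where
      split : T ⌊ mateShift i j + x ∈? centred 6 ⌋ × T (not ⌊ window 6 (lookup heavyWindows j) x Bool.≟ window 6 (lookup heavyWindows i) (mateShift i j + x) ⌋)
      split = Equivalence.to (T-∧ {⌊ mateShift i j + x ∈? centred 6 ⌋}) disagree

module HeavyCodewords {m : ℕ} (12≤m : 12 ≤ m) (S : Subset (suc m)) (locating : IsLocatingCode S) where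
  open import Data.Nat as ℕ using (s≤s)
  import Data.Nat.Properties as ℕP
  open import Data.Integer as ℤ using (ℤ; +_; 0ℤ; _+_; _-_; ∣_∣)
  open import Data.Rational as ℚ using (_/_)
  open import Data.Bool using (Bool; T)
  open import Data.Bool.Properties using (T-≡)
  open import Data.Fin using (Fin)
  open import Data.Fin.Properties using (all?)
  open import Data.Fin.Subset using (_∈_)
  open import Data.Vec using (Vec; lookup)
  open import Data.Vec.Properties using ([]=⇒lookup; lookup⇒[]=)
  open import Data.List.Relation.Binary.Subset.Propositional using (_⊆_)
  open import Data.List.Relation.Unary.All as All using (All)
  open import Data.List.Relation.Unary.All.Properties using (anti-mono)
  open import Data.Product using (∃-syntax; _×_; _,_; proj₁; proj₂)
  open import Data.Sum using (_⊎_)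
  open import Function.Bundles using (Equivalence)
  open import Relation.Binary.PropositionalEquality
  open import Relation.Nullary using (yes; no)
  open import Relation.Nullary.Decidable using (⌊_⌋; toWitness; fromWitness)
  open import Defs using (share; profile; Heavy)
  open Cyclic
  open ClosedNeighbourhood
  open LocalView
  open Locating
  open Search

  mateOffsetOf : Vec Bool 13 → ℤ
  mateOffsetOf v with heavyWindowOf? v
  ... | yes (i , _) = lookup mateOffsets i
  ... | no _        = 0ℤ

  mateOffsetOf-heavyWindow : ∀ i → mateOffsetOf (lookup heavyWindows i) ≡ lookup mateOffsets i
  mateOffsetOf-heavyWindow = toWitness {a? = all? λ i → mateOffsetOf (lookup heavyWindows i) ℤ.≟ lookup mateOffsets i} _

  private
    n = suc m
    6≤m : 6 ℕ.≤ m
    6≤m = ℕP.≤-trans (ℕP.≤ᵇ⇒≤ 6 12 _) 12≤m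

  viewAt : Fin n → Pattern
  viewAt = view 6≤m S

  windowAt : Fin n → Vec Bool 13
  windowAt u = sample 6 (viewAt u)

  shareAt-window : ∀ r u x → twoStepBall x ⊆ centred r → shareAt (window r (sample r (viewAt u))) x ≡ share S (u ⊕ x)
  shareAt-window r u x ball⊆ =
    trans (shareAt-cong {x = x} (anti-mono ball⊆ (window-sample r (viewAt u)))) (sym (share≡shareAt 6≤m S u x))

  profileAt-window : ∀ u → profileAt (window 6 (windowAt u)) 0ℤ ≡ profile S u
  profileAt-window u = begin
    profileAt (window 6 (windowAt u)) 0ℤ  ≡⟨ profileAt-cong {x = 0ℤ} (anti-mono twoStepBall-0⊆centred6 (window-sample 6 (viewAt u))) ⟩
    profileAt (viewAt u) 0ℤ               ≡⟨ profile≡profileAt 6≤m S u 0ℤ ⟨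
    profile S (u ⊕ 0ℤ)                    ≡⟨ cong (profile S) (⊕-identityʳ u) ⟩
    profile S u                           ∎
    where open ≡-Reasoning

  classified : ∀ u → u ∈ S → Heavy S u →
    T ⌊ heavyWindowOf? (windowAt u) ⌋ × T (isHeavyProfile (profileAt (window 6 (windowAt u)) 0ℤ))
  classified u u∈S heavy = classification-sound (windowAt u) u∈S′ heavy′ locating′
    where
    u∈S′ : T (window 6 (windowAt u) 0ℤ)
    u∈S′ = Equivalence.from T-≡ (trans (cong (lookup S) (⊕-identityʳ u)) ([]=⇒lookup u∈S))
    heavy′ : T (heavyAt (window 6 (windowAt u)))
    heavy′ = fromWitness (subst (ℚ._<_ (+ 3 / 1))
      (sym (trans (shareAt-window 6 u 0ℤ twoStepBall-0⊆centred6) (cong (share S) (⊕-identityʳ u)))) heavy)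
    near : All (λ x → All (λ y → ∣ x - y ∣ ℕ.< n) (centred 3)) (centred 3)
    near = All.map (All.map λ ∣x-y∣≤6 → s≤s (ℕP.≤-trans ∣x-y∣≤6 6≤m)) centred3-near
    locating′ : T (locatingAt (window 6 (windowAt u)) (centred 3))
    locating′ = subst T (sym (locatingAt-window (viewAt u))) (locatingAt-view 6≤m S u locating near)

  heavyWindowAt : ∀ u → u ∈ S → Heavy S u → ∃[ i ] windowAt u ≡ lookup heavyWindows i
  heavyWindowAt u u∈S heavy = toWitness {a? = heavyWindowOf? (windowAt u)} (proj₁ (classified u u∈S heavy))

  heavy-profile : ∀ u → u ∈ S → Heavy S u → profile S u ≡ heavyProfile₁ ⊎ profile S u ≡ heavyProfile₂
  heavy-profile u u∈S heavy = subst (λ p → p ≡ _ ⊎ p ≡ _) (profileAt-window u)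
    (isHeavyProfile-sound (profileAt (window 6 (windowAt u)) 0ℤ) (proj₂ (classified u u∈S heavy)))

  mate : Fin n → Fin n
  mate u = u ⊕ mateOffsetOf (windowAt u)

  mate-heavyWindow : ∀ {u i} → windowAt u ≡ lookup heavyWindows i → mate u ≡ u ⊕ lookup mateOffsets i
  mate-heavyWindow {u} {i} eq = cong (u ⊕_) (trans (cong mateOffsetOf eq) (mateOffsetOf-heavyWindow i))

  mate-bound : ∀ u → u ∈ S → Heavy S u → mate u ∈ S × share S u ℚ.+ share S (mate u) ℚ.≤ + 6 / 1
  mate-bound u u∈S heavy = lookup⇒[]= (mate u) S (trans (cong (lookup S) mate≡) (trans (sym mate-agrees) (Equivalence.to T-≡ (proj₁ bound))))
                         , subst₂ (λ γ γ′ → γ ℚ.+ γ′ ℚ.≤ + 6 / 1) share-u share-mate (proj₂ bound)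
    where
    i : Fin 6
    i = proj₁ (heavyWindowAt u u∈S heavy)
    d : ℤ
    d = lookup mateOffsets i
    mate≡ : mate u ≡ u ⊕ d
    mate≡ = mate-heavyWindow {u} {i} (proj₂ (heavyWindowAt u u∈S heavy))
    wide≡ : widen (lookup heavyWindows i) (rim (viewAt u)) ≡ sample 10 (viewAt u)
    wide≡ = trans (cong (λ v → widen v (rim (viewAt u))) (sym (proj₂ (heavyWindowAt u u∈S heavy)))) (sym (sample-widen (viewAt u)))
    bound : MateBound i (sample 10 (viewAt u))
    bound = subst (MateBound i) wide≡ (mateBound-sound i (rim (viewAt u)))
    b : Pattern
    b = window 10 (sample 10 (viewAt u))
    mate-agrees : b d ≡ viewAt u d
    mate-agrees = All.lookup (window-sample 10 (viewAt u)) (mateOffset∈centred10 i)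
    share-u : shareAt b 0ℤ ≡ share S u
    share-u = trans (shareAt-window 10 u 0ℤ twoStepBall-0⊆centred10) (cong (share S) (⊕-identityʳ u))
    share-mate : shareAt b d ≡ share S (mate u)
    share-mate = trans (shareAt-window 10 u d (twoStepBall-mate⊆centred10 i)) (cong (share S) (sym mate≡))

  mate-injective : ∀ u v → u ∈ S → Heavy S u → v ∈ S → Heavy S v → mate u ≡ mate v → u ≡ v
  mate-injective u v u∈S heavyᵤ v∈S heavyᵥ mate≡mate = begin
    u                     ≡⟨ ⊕-identityʳ u ⟨
    u ⊕ 0ℤ                ≡⟨ cong (u ⊕_) k≡0 ⟨
    u ⊕ mateShift i j     ≡⟨ u⊕k≡v ⟩
    v                     ∎
    where
    open ≡-Reasoning
    i j : Fin 6
    i = proj₁ (heavyWindowAt u u∈S heavyᵤ)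
    j = proj₁ (heavyWindowAt v v∈S heavyᵥ)
    u⊕k≡v : u ⊕ mateShift i j ≡ v
    u⊕k≡v = ⊕-difference (lookup mateOffsets i) (lookup mateOffsets j)
      (trans (sym (mate-heavyWindow {u} {i} (proj₂ (heavyWindowAt u u∈S heavyᵤ))))
             (trans mate≡mate (mate-heavyWindow {v} {j} (proj₂ (heavyWindowAt v v∈S heavyᵥ)))))
    agreeᵢ : window 6 (lookup heavyWindows i) ≐ viewAt u on centred 6
    agreeᵢ = subst (λ w → window 6 w ≐ viewAt u on centred 6) (proj₂ (heavyWindowAt u u∈S heavyᵤ)) (window-sample 6 (viewAt u))
    agreeⱼ : window 6 (lookup heavyWindows j) ≐ (λ x → viewAt u (mateShift i j + x)) on centred 6
    agreeⱼ = subst (λ w → window 6 w ≐ (λ x → viewAt u (mateShift i j + x)) on centred 6) (proj₂ (heavyWindowAt v v∈S heavyᵥ))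
      (All.map (λ {x} agrees → trans agrees (cong (lookup S) (trans (cong (_⊕ x) (sym u⊕k≡v)) (⊕-assoc u (mateShift i j) x))))
        (window-sample 6 (viewAt v)))
    k≡0 : mateShift i j ≡ 0ℤ
    k≡0 = separatedMates-sound i j agreeᵢ agreeⱼ


open import Defs
open import Data.Nat using (ℕ; _≤_; s≤s)
open import Data.Fin using (Fin)
open import Data.Fin.Subset using (Subset; _∈_)
open import Data.List using (List; []; _∷_)
open import Data.Integer using (+_)
open import Data.Rational using (_/_; _+_) renaming (_≤_ to _≤ℚ_)
open import Data.Product using (Σ; _×_; _,_)
open import Data.Sum using (_⊎_)
open import Relation.Binary.PropositionalEquality using (_≡_)

lemma2 : (n : ℕ) → 13 ≤ n → (S : Subset n) → IsLocatingCode S →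
    ((u : Fin n) → u ∈ S → Heavy S u →
    (profile S u ≡ 1 ∷ 1 ∷ 2 ∷ 2 ∷ 3 ∷ []) ⊎ (profile S u ≡ 1 ∷ 1 ∷ 2 ∷ 3 ∷ 4 ∷ []))
    × Σ (Fin n → Fin n) (λ mate →
    ((u : Fin n) → u ∈ S → Heavy S u →
    (mate u ∈ S) × ((share S u + share S (mate u)) ≤ℚ (+ 6 / 1)))
    × ((u v : Fin n) → u ∈ S → Heavy S u → v ∈ S → Heavy S v →
    mate u ≡ mate v → u ≡ v))
lemma2 (suc m) (s≤s 12≤m) S locating = heavy-profile , mate , mate-bound , mate-injective
  where open HeavyCodewords 12≤m S locating
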